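{- Let $X$ be a string, $\tau\ge1$ an integer, and suppose the first $i-1$ factors $F_1,\dots,F_{i-1}$ of the LZ-End+$\tau$ factorization of $X$ have been determined, so that the next factor starts at position $s_i$. If the $\tau$-far property holds for an index $j > s_i$, then it holds for $j-1$.
   Context: LZ-End+$\tau$ factorization: constructed left to right starting from position $1$. At current position $p$, if $X[p]$ does not occur in $X[1\,.\,.\,p)$ then $X[p]$ is a new factor; otherwise the new factor is $X[p\,.\,.\,q]$ for the largest $q$ such that $X[p\,.\,.\,q]$ has an occurrence ending either at the last position of an earlier factor or at a position $k<p$ with $k\equiv1\pmod\tau$. With $F_1,\dots,F_{i-1}$ fixed and $s_i$ the starting position of the next factor, a fragment $X[s_i\,.\,.\,h]$ is a potential factor if either $h=s_i$ and $X[s_i]$ is the leftmost occurrence of that symbol in $X$, or $X[s_i\,.\,.\,h]=X[x\,.\,.\,y]$ for some $x\le y< s_i$ where $y$ is the last position of one of $F_1,\dots,F_{i-1}$ or $y\equiv 1\pmod{\tau}$. The $\tau$-far property holds for an index $j\ge s_i$ if there exists $h$ with $\max(s_i,j-\tau)\le h\le j$ such that $X[s_i\,.\,.\,h]$ is a potential factor. -}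

module Defs where

open import Data.Nat using (ℕ; zero; suc; _+_; _∸_; _≤_; _<_; _⊔_; NonZero)
open import Data.Nat.DivMod using (_%_)
open import Data.List using (List; []; _∷_)
open import Data.List.Membership.Propositional using (_∈_)
open import Data.Product using (Σ; ∃; _×_; _,_)
open import Data.Sum using (_⊎_)
open import Relation.Nullary using (¬_)
open import Relation.Binary.PropositionalEquality using (_≡_; _≢_)

-- A string X of length n is modelled as X : ℕ → A, where only the
-- positions 1 .. n (1-indexed) are meaningful.
-- The end positions of the already-fixed factors F_1 … F_{i-1} are kept in
-- a list E in REVERSE order (last factor's end first).

module _ {A : Set} (X : ℕ → A) (n τ : ℕ) .{{_ : NonZero τ}} where

  start : List ℕ → ℕ
  start []      = 1
  start (e ∷ _) = suc e

  Leftmost : ℕ → Set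
  Leftmost p = ∀ k → 1 ≤ k → k < p → X k ≢ X p

  Good : List ℕ → ℕ → Set
  Good E y = (y ∈ E) ⊎ (y % τ ≡ 1 % τ)

  SameFrag : ℕ → ℕ → ℕ → ℕ → Set
  SameFrag p q x y = (y ∸ x ≡ q ∸ p) × (∀ k → k ≤ q ∸ p → X (p + k) ≡ X (x + k))

  OccGood : List ℕ → ℕ → ℕ → Set
  OccGood E p q =
    (p ≤ q) × (q ≤ n) ×
    ∃ λ x → ∃ λ y → (1 ≤ x) × (x ≤ y) × (y < p) × Good E y × SameFrag p q x y

  Step : List ℕ → ℕ → ℕ → Set
  Step E p q =
    (Leftmost p × q ≡ p)
    ⊎ (¬ Leftmost p × OccGood E p q × (∀ q' → OccGood E p q' → q' ≤ q))

  data LZEndτPrefix : List ℕ → Set where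
    []   : LZEndτPrefix []
    step : ∀ {E q} → LZEndτPrefix E → start E ≤ n → Step E (start E) q →
           LZEndτPrefix (q ∷ E)

  Potential : List ℕ → ℕ → Set
  Potential E h =
    (h ≡ start E × start E ≤ n × Leftmost (start E))
    ⊎ OccGood E (start E) h

  TauFar : List ℕ → ℕ → Set
  TauFar E j = ∃ λ h → ((start E ⊔ (j ∸ τ)) ≤ h) × (h ≤ j) × Potential E h

{-# OPTIONS --safe #-}
module Submission where

-- If the witness h for j is below j, it also witnesses j - 1. Otherwise h = j > s,
-- so X[s .. j] occurs ending at a good position y < s. Cutting k symbols off the
-- end, where 1 ≤ k ≤ τ and y - k ≡ 1 (mod τ), leaves the potential factor
-- X[s .. j - k], and j - τ ≤ j - k < j. When the fragment is too short to cut,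
-- X[s] alone is a potential factor: every symbol of the parsed prefix also
-- occurs at the end of some factor.

open import Defs
open import Data.Nat using (ℕ; zero; suc; _+_; _*_; _≤_; _<_; _∸_; z≤n; s≤s; s≤s⁻¹; NonZero; _<?_; _≤?_)
open import Data.Nat.Properties
open import Data.Nat.DivMod using (_%_; _/_; m≡m%n+[m/n]*n; [m+kn]%n≡m%n; m%n<n; m%n≤m)
open import Data.List using (List; []; _∷_)
open import Data.List.Membership.Propositional using (_∈_)
open import Data.List.Relation.Unary.Any using (here; there)
open import Data.Product using (∃; _×_; _,_)
open import Data.Sum using (inj₁; inj₂)
open import Relation.Nullary using (yes; no)
open import Data.Empty using (⊥-elim)
open import Relation.Binary.PropositionalEquality

≡1-mod-τ-below : ∀ τ .{{_ : NonZero τ}} y → 2 ≤ y →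
                ∃ λ k → 1 ≤ k × k ≤ τ × (y ∸ k) % τ ≡ 1 % τ
≡1-mod-τ-below τ (suc zero)    (s≤s ())
≡1-mod-τ-below τ (suc (suc m)) _ = suc (m % τ) , s≤s z≤n , m%n<n m τ , ≡1
  where
  open ≡-Reasoning
  ≡1 : (suc m ∸ m % τ) % τ ≡ 1 % τ
  ≡1 = begin
    (suc m ∸ m % τ) % τ              ≡⟨ cong (_% τ) (+-∸-assoc 1 (m%n≤m m τ)) ⟩
    (1 + (m ∸ m % τ)) % τ            ≡⟨ cong (λ t → (1 + (t ∸ m % τ)) % τ) (m≡m%n+[m/n]*n m τ) ⟩
    (1 + (m % τ + m / τ * τ ∸ m % τ)) % τ
                                     ≡⟨ cong (λ t → (1 + t) % τ) (m+n∸m≡n (m % τ) (m / τ * τ)) ⟩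
    (1 + m / τ * τ) % τ              ≡⟨ [m+kn]%n≡m%n 1 (m / τ) τ ⟩
    1 % τ                            ∎

module _ {A : Set} (X : ℕ → A) (n τ : ℕ) .{{_ : NonZero τ}} where

  1≤start : ∀ E → 1 ≤ start X n τ E
  1≤start []      = s≤s z≤n
  1≤start (_ ∷ _) = s≤s z≤n

  Step⇒≤ : ∀ {E p q} → Step X n τ E p q → p ≤ q
  Step⇒≤ (inj₁ (_ , refl))           = ≤-refl
  Step⇒≤ (inj₂ (_ , (p≤q , _) , _)) = p≤q

  SameFrag-prefix : ∀ {p q x y} d → d ≤ q ∸ p → SameFrag X n τ p q x y →
                    SameFrag X n τ p (p + d) x (x + d)
  SameFrag-prefix {p} {x = x} d d≤ (_ , same) =
    trans (m+n∸m≡n x d) (sym (m+n∸m≡n p d)) ,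
    λ k k≤ → same k (≤-trans (subst (k ≤_) (m+n∸m≡n p d) k≤) d≤)

  SameFrag-single : ∀ {p x} → X p ≡ X x → SameFrag X n τ p p x x
  SameFrag-single {p} {x} eq = trans (n∸n≡0 x) (sym (n∸n≡0 p)) , same
    where
    same : ∀ k → k ≤ p ∸ p → X (p + k) ≡ X (x + k)
    same k k≤ with ≤-antisym (subst (k ≤_) (n∸n≡0 p) k≤) z≤n
    ... | refl = subst₂ (λ a b → X a ≡ X b) (sym (+-identityʳ p)) (sym (+-identityʳ x)) eq

  -- Following a symbol back through the sources of the copying factors ends at
  -- a one-symbol factor.
  symbol-at-factor-end : ∀ {E} → LZEndτPrefix X n τ E → ∀ k → 1 ≤ k → k < start X n τ E →
                         ∃ λ y → y ∈ E × 1 ≤ y × y < start X n τ E × X y ≡ X k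
  symbol-at-factor-end [] (suc _) _ (s≤s ())
  symbol-at-factor-end (step {E} {q} pr _ st) k 1≤k k≤q
    with k <? start X n τ E
  ... | yes k<s with symbol-at-factor-end pr k 1≤k k<s
  ...   | y , y∈E , 1≤y , y<s , eq = y , there y∈E , 1≤y , <-≤-trans y<s (m≤n⇒m≤1+n (Step⇒≤ st)) , eq
  symbol-at-factor-end (step {E} {q} pr _ (inj₁ (_ , refl))) k _ k≤q | no k≮s =
    q , here refl , 1≤start E , ≤-refl , cong X (≤-antisym (≮⇒≥ k≮s) (s≤s⁻¹ k≤q))
  symbol-at-factor-end (step {E} {q} pr _ (inj₂ (_ , (s≤q , _ , x , y , 1≤x , x≤y , y<s , _ , len , same) , _))) k _ k≤q | no k≮s
    with symbol-at-factor-end pr (x + d) (≤-trans 1≤x (m≤m+n x d)) source<s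
    where
    s = start X n τ E
    d = k ∸ s
    d≤ : d ≤ y ∸ x
    d≤ = subst (d ≤_) (sym len) (∸-monoˡ-≤ s (s≤s⁻¹ k≤q))
    source<s : x + d < s
    source<s = ≤-<-trans (subst (x + d ≤_) (m+[n∸m]≡n x≤y) (+-monoʳ-≤ x d≤)) y<s
  ... | y₁ , y₁∈E , 1≤y₁ , y₁<s , eq =
    y₁ , there y₁∈E , 1≤y₁ , <-≤-trans y₁<s (m≤n⇒m≤1+n s≤q) ,
    trans eq (trans (sym (same d (∸-monoˡ-≤ s (s≤s⁻¹ k≤q)))) (cong X (m+[n∸m]≡n (≮⇒≥ k≮s))))
    where
    s = start X n τ E
    d = k ∸ s

  TauFar-pred : ∀ {E j} h → start X n τ E ≤ h → h < j → j ∸ τ ≤ h →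
                Potential X n τ E h → TauFar X n τ E (j ∸ 1)
  TauFar-pred {E} {suc j} h s≤h (s≤s h≤j) j∸τ≤h pot =
    h , ⊔-lub s≤h (≤-trans (∸-monoˡ-≤ τ (n≤1+n j)) j∸τ≤h) , h≤j , pot

  OccGood⇒Potential-start : ∀ {E j} → LZEndτPrefix X n τ E →
                    OccGood X n τ E (start X n τ E) j → Potential X n τ E (start X n τ E)
  OccGood⇒Potential-start {E} pr (s≤j , j≤n , x , y , 1≤x , x≤y , y<s , _ , _ , same)
    with symbol-at-factor-end pr x 1≤x (≤-<-trans x≤y y<s)
  ... | y₁ , y₁∈E , 1≤y₁ , y₁<s , eq =
    inj₂ (≤-refl , ≤-trans s≤j j≤n , y₁ , y₁ , 1≤y₁ , ≤-refl , y₁<s , inj₁ y₁∈E ,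
          SameFrag-single (trans (subst₂ (λ a b → X a ≡ X b) (+-identityʳ s) (+-identityʳ x) (same 0 z≤n)) (sym eq)))
    where s = start X n τ E

  OccGood⇒TauFar-pred : ∀ {E j} → LZEndτPrefix X n τ E → start X n τ E < j →
                        OccGood X n τ E (start X n τ E) j → TauFar X n τ E (j ∸ 1)
  OccGood⇒TauFar-pred {E} {j} pr s<j occ@(s≤j , j≤n , x , y , 1≤x , x≤y , y<s , _ , sf@(len , _))
    with ≡1-mod-τ-below τ y 2≤y
    where
    s = start X n τ E
    2≤y : 2 ≤ y
    2≤y = subst (2 ≤_) (m+[n∸m]≡n x≤y) (+-mono-≤ 1≤x (subst (1 ≤_) (sym len) (m<n⇒0<n∸m s<j)))
  ... | k , 1≤k , k≤τ , y∸k≡1 with k ≤? j ∸ start X n τ E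
  ...   | no k≰L = TauFar-pred s ≤-refl s<j j∸τ≤s (OccGood⇒Potential-start pr occ)
    where
    s = start X n τ E
    j∸τ≤s : j ∸ τ ≤ s
    j∸τ≤s = subst (j ∸ τ ≤_) (m∸[m∸n]≡n s≤j) (∸-monoʳ-≤ j (≤-trans (<⇒≤ (≰⇒> k≰L)) k≤τ))
  ...   | yes k≤L = TauFar-pred (s + M) (m≤m+n s M) h<j j∸τ≤h
                      (inj₂ (m≤m+n s M , ≤-trans (<⇒≤ h<j) j≤n , x , x + M , 1≤x , m≤m+n x M ,
                             ≤-<-trans (subst (x + M ≤_) y≡x+L (+-monoʳ-≤ x (m∸n≤m L k))) y<s ,
                             inj₂ (subst (λ t → t % τ ≡ 1 % τ) y∸k≡x+M y∸k≡1) ,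
                             SameFrag-prefix M (m∸n≤m L k) sf))
    where
    s = start X n τ E
    L = j ∸ s
    M = L ∸ k
    y≡x+L : x + L ≡ y
    y≡x+L = trans (cong (x +_) (sym len)) (m+[n∸m]≡n x≤y)
    y∸k≡x+M : y ∸ k ≡ x + M
    y∸k≡x+M = trans (cong (_∸ k) (sym y≡x+L)) (+-∸-assoc x k≤L)
    j∸k≡h : j ∸ k ≡ s + M
    j∸k≡h = trans (cong (_∸ k) (sym (m+[n∸m]≡n s≤j))) (+-∸-assoc s k≤L)
    h<j : s + M < j
    h<j = subst (s + M <_) (m+[n∸m]≡n s≤j) (+-monoʳ-< s (∸-monoʳ-< 1≤k k≤L))
    j∸τ≤h : j ∸ τ ≤ s + M
    j∸τ≤h = subst (j ∸ τ ≤_) j∸k≡h (∸-monoʳ-≤ j k≤τ)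

lemma5p3 : {A : Set} (X : ℕ → A) (n τ : ℕ) .{{_ : NonZero τ}}
    (E : List ℕ) → LZEndτPrefix X n τ E →
    (j : ℕ) → start X n τ E < j →
    TauFar X n τ E j → TauFar X n τ E (j ∸ 1)
lemma5p3 X n τ E pr j s<j (h , lo , h≤j , pot) with h ≟ j
... | no h≢j = TauFar-pred X n τ h (≤-trans (m≤m⊔n _ _) lo) (≤∧≢⇒< h≤j h≢j) (≤-trans (m≤n⊔m _ _) lo) pot
... | yes refl with pot
...   | inj₁ (h≡s , _) = ⊥-elim (<-irrefl (sym h≡s) s<j)
...   | inj₂ occ       = OccGood⇒TauFar-pred X n τ pr s<j occ
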